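{- The set $\mathcal G^0\cup\{1\}$ is a free monoid for the concatenation product of ordered forests.
   Context: An ordered forest of degree $n\ge 0$ is a planar rooted forest with $n$ vertices (a left-to-right sequence of rooted trees, the children of each vertex linearly ordered from left to right) together with a bijection from its vertex set to $\{1,\dots,n\}$ (labels); edges point towards roots. $1$ is the empty forest, $\bullet_1$ the one-vertex tree, $|F|$ the degree. The product $FG$ is concatenation (trees of $F$, then trees of $G$), labels of $F$ kept and labels of $G$ increased by $|F|$. For $n\ge1$ and $\underline\varepsilon=(\varepsilon_1,\dots,\varepsilon_n)\in\{+,-\}^n$ define sets $\mathcal G^{(\underline\varepsilon)}$ of ordered forests of degree $n$ recursively: $\mathcal G^{(\varepsilon_1)}=\{\bullet_1\}$; for $n\ge2$, let $F'$ range over $\mathcal G^{(\varepsilon_1,\dots,\varepsilon_{n-1})}$ with trees $T_1,\dots,T_m$ from left to right; all vertices of $F'$ keep their labels and a new vertex labelled $n$ is added. If $\varepsilon_n=-$: add a new root whose children are the roots of $T_1,\dots,T_m$ in order. If $\varepsilon_n=+$: either add the new vertex as a one-vertex tree at the right end, or, for some $1\le i\le m$, attach the new vertex as rightmost child of the root of $T_i$ and make the roots of $T_{i+1},\dots,T_m$ (in order) the children of the new vertex. $\mathcal G^0=\bigcup_{n\ge1}\mathcal G^{(+,\dots,+)}$, the union over the words of length $n$ consisting only of $+$. -}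

module Defs where

open import Data.Nat using (ℕ; zero; suc; _+_; _≥_)
open import Data.List using (List; []; _∷_; _++_; [_]; _∷ʳ_; length; replicate; foldr)
open import Data.List.Relation.Unary.All using (All)
open import Data.Product using (Σ; _×_; ∃; _,_)
open import Data.Sum using (_⊎_)
open import Relation.Binary.PropositionalEquality using (_≡_)

data Tree : Set where
  node : ℕ → List Tree → Tree

Forest : Set
Forest = List Tree

mutual
  sizeT : Tree → ℕ
  sizeT (node _ ts) = suc (sizeF ts)

  sizeF : Forest → ℕ
  sizeF [] = 0
  sizeF (t ∷ ts) = sizeT t + sizeF ts

mutual
  shiftT : ℕ → Tree → Tree
  shiftT k (node l ts) = node (k + l) (shiftF k ts)

  shiftF : ℕ → Forest → Forest
  shiftF k [] = []
  shiftF k (t ∷ ts) = shiftT k t ∷ shiftF k ts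

𝟙 : Forest
𝟙 = []

infixr 6 _·_
_·_ : Forest → Forest → Forest
F · G = F ++ shiftF (sizeF F) G

data Sign : Set where
  ⊕ ⊖ : Sign

-- Gen w F  :  F ∈ 𝒢^(w), following the recursive construction.
-- The new vertex added at step n = length of the new word gets label n.
data Gen : List Sign → Forest → Set where
  base  : ∀ s → Gen (s ∷ []) [ node 1 [] ]
  minus : ∀ {w F} → Gen w F →
          Gen (w ∷ʳ ⊖) [ node (suc (length w)) F ]
  plusNew : ∀ {w F} → Gen w F →
            Gen (w ∷ʳ ⊕) (F ++ [ node (suc (length w)) [] ])
  -- ε_n = + : F = T_1..T_{i-1} T_i T_{i+1}..T_m ; new vertex becomes the
  -- rightmost child of the root of T_i and the roots of T_{i+1}..T_m become
  -- its children.
  plusGraft : ∀ {w} (A : Forest) (l : ℕ) (cs B : Forest) →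
              Gen w (A ++ node l cs ∷ B) →
              Gen (w ∷ʳ ⊕) (A ++ [ node l (cs ++ [ node (suc (length w)) B ]) ])

G⁰ : Forest → Set
G⁰ F = Σ ℕ λ n → n ≥ 1 × Gen (replicate n ⊕) F

G⁰∪𝟙 : Forest → Set
G⁰∪𝟙 F = F ≡ 𝟙 ⊎ G⁰ F

prod : List Forest → Forest
prod = foldr _·_ 𝟙

IsFreeMonoid : (Forest → Set) → Set₁
IsFreeMonoid M =
  M 𝟙 ×
  (∀ F G → M F → M G → M (F · G)) ×
  Σ (Forest → Set) λ B →
    (∀ b → B b → M b) ×
    (∀ F → M F →
      Σ (List Forest) λ bs → All B bs × prod bs ≡ F ×
        (∀ cs → All B cs → prod cs ≡ F → cs ≡ bs))

-- In a forest of 𝒢⁰ with first tree t, the vertices of t carry the labels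
-- 1, …, |t|: a graft at a tree absorbs every tree to its right, so a vertex
-- added after a vertex lying outside the first tree never ends up in it. The
-- construction therefore splits into one building [t] ∈ 𝒢⁰, followed, to the
-- right and with labels raised by |t|, by one building an element of 𝒢⁰ ∪ {1}.
-- Conversely, running the construction of G to the right of F builds F G.
-- So every element is a product of one-tree forests of 𝒢⁰, uniquely, since
-- such a product lists the shifted trees in order and shifting is injective.
module Submission where

open import Defs
open import Data.Nat using (ℕ; zero; suc; _+_; _<_; s≤s; z≤n)
open import Data.Nat.Properties using (+-suc; +-identityʳ; +-comm; +-assoc; +-cancelˡ-≡; m<n+m)
open import Data.Nat.Induction using (<-wellFounded)
open import Data.List using (List; []; _∷_; _++_; [_]; _∷ʳ_; length; replicate)
open import Data.List.Properties using (++-assoc; ++-identityʳ; ++-conicalʳ; length-replicate; ∷-injective)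
open import Data.List.Relation.Unary.All as All using (All; []; _∷_)
open import Data.List.Relation.Unary.All.Properties using (∷ʳ⁻; replicate⁺)
open import Data.Product using (_×_; ∃; ∃₂; _,_; proj₁; proj₂)
open import Data.Sum using (inj₁; inj₂)
open import Function using (_∘_)
open import Induction.WellFounded using (Acc; acc)
open import Relation.Binary.PropositionalEquality
  using (_≡_; refl; sym; trans; cong; cong₂; subst; subst₂; module ≡-Reasoning)

shiftF-++ : ∀ k X Y → shiftF k (X ++ Y) ≡ shiftF k X ++ shiftF k Y
shiftF-++ k []      Y = refl
shiftF-++ k (x ∷ X) Y = cong (shiftT k x ∷_) (shiftF-++ k X Y)

node-injective : ∀ {l l′ ts ts′} → node l ts ≡ node l′ ts′ → l ≡ l′ × ts ≡ ts′
node-injective refl = refl , refl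

mutual
  shiftT-injective : ∀ k {s t} → shiftT k s ≡ shiftT k t → s ≡ t
  shiftT-injective k {node l ts} {node l′ ts′} eq =
    let l≡l′ , ts≡ts′ = node-injective eq
    in cong₂ node (+-cancelˡ-≡ k l l′ l≡l′) (shiftF-injective k ts≡ts′)

  shiftF-injective : ∀ k {X Y} → shiftF k X ≡ shiftF k Y → X ≡ Y
  shiftF-injective k {[]}    {[]}    eq = refl
  shiftF-injective k {x ∷ X} {y ∷ Y} eq =
    let x≡y , X≡Y = ∷-injective eq
    in cong₂ _∷_ (shiftT-injective k x≡y) (shiftF-injective k X≡Y)

shiftF-++⁻ : ∀ k X A Y → shiftF k X ≡ A ++ Y →
             ∃₂ λ X₁ X₂ → X ≡ X₁ ++ X₂ × shiftF k X₁ ≡ A × shiftF k X₂ ≡ Y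
shiftF-++⁻ k X       []      Y eq = [] , X , refl , refl , eq
shiftF-++⁻ k (x ∷ X) (a ∷ A) Y eq =
  let x≡a , X≡AY = ∷-injective eq
      X₁ , X₂ , X≡ , X₁≡ , X₂≡ = shiftF-++⁻ k X A Y X≡AY
  in x ∷ X₁ , X₂ , cong (x ∷_) X≡ , cong₂ _∷_ x≡a X₁≡ , X₂≡

sizeF-++ : ∀ X Y → sizeF (X ++ Y) ≡ sizeF X + sizeF Y
sizeF-++ []      Y = refl
sizeF-++ (x ∷ X) Y = trans (cong (sizeT x +_) (sizeF-++ X Y)) (sym (+-assoc (sizeT x) (sizeF X) (sizeF Y)))

mutual
  sizeT-shiftT : ∀ k t → sizeT (shiftT k t) ≡ sizeT t
  sizeT-shiftT k (node l ts) = cong suc (sizeF-shiftF k ts)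

  sizeF-shiftF : ∀ k X → sizeF (shiftF k X) ≡ sizeF X
  sizeF-shiftF k []      = refl
  sizeF-shiftF k (t ∷ X) = cong₂ _+_ (sizeT-shiftT k t) (sizeF-shiftF k X)

sizeF-∷ʳ : ∀ X t → sizeF (X ∷ʳ t) ≡ sizeF X + sizeT t
sizeF-∷ʳ X t = trans (sizeF-++ X [ t ]) (cong (sizeF X +_) (+-identityʳ (sizeT t)))

sizeF-graft : ∀ A l cs k B →
              sizeF (A ++ [ node l (cs ++ [ node k B ]) ]) ≡ suc (sizeF (A ++ node l cs ∷ B))
sizeF-graft []      l cs k B = begin
  suc (sizeF (cs ++ [ node k B ])) + 0  ≡⟨ +-identityʳ _ ⟩
  suc (sizeF (cs ++ [ node k B ]))      ≡⟨ cong suc (sizeF-∷ʳ cs (node k B)) ⟩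
  suc (sizeF cs + suc (sizeF B))        ≡⟨ cong suc (+-suc (sizeF cs) (sizeF B)) ⟩
  suc (suc (sizeF cs + sizeF B))        ∎
  where open ≡-Reasoning
sizeF-graft (a ∷ A) l cs k B = trans (cong (sizeT a +_) (sizeF-graft A l cs k B)) (+-suc (sizeT a) _)

-- Gen⁺ n F  ⇔  F ∈ 𝒢^(+,…,+) with n letters, extended by Gen⁺ 0 1 so that
-- 𝒢⁰ ∪ {1} becomes a single inductive family.
data Gen⁺ : ℕ → Forest → Set where
  empty  : Gen⁺ 0 []
  pnew   : ∀ {n F} → Gen⁺ n F → Gen⁺ (suc n) (F ∷ʳ node (suc n) [])
  pgraft : ∀ {n} A l cs B → Gen⁺ n (A ++ node l cs ∷ B) →
           Gen⁺ (suc n) (A ++ [ node l (cs ++ [ node (suc n) B ]) ])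

Gen⁺-size : ∀ {n F} → Gen⁺ n F → sizeF F ≡ n
Gen⁺-size empty               = refl
Gen⁺-size (pnew {n} {F} p)    = trans (sizeF-∷ʳ F _) (trans (cong (_+ 1) (Gen⁺-size p)) (+-comm n 1))
Gen⁺-size (pgraft A l cs B p) = trans (sizeF-graft A l cs _ B) (cong suc (Gen⁺-size p))

Gen⁺-zero : ∀ {F} → Gen⁺ 0 F → F ≡ []
Gen⁺-zero empty = refl

Gen⁺-cast : ∀ {m n F} → m ≡ n → Gen⁺ m F → Gen⁺ n F
Gen⁺-cast refl p = p

length-∷ʳ : ∀ {A : Set} (xs : List A) x → length (xs ∷ʳ x) ≡ suc (length xs)
length-∷ʳ []       x = refl
length-∷ʳ (_ ∷ xs) x = cong suc (length-∷ʳ xs x)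

replicate-∷ʳ : ∀ {A : Set} n (x : A) → replicate (suc n) x ≡ replicate n x ∷ʳ x
replicate-∷ʳ zero    x = refl
replicate-∷ʳ (suc n) x = cong (x ∷_) (replicate-∷ʳ n x)

Gen→Gen⁺ : ∀ {w F} → Gen w F → All (_≡ ⊕) w → Gen⁺ (length w) F
Gen→Gen⁺ (base s)                  _ = pnew empty
Gen→Gen⁺ (minus {w} g)             a with () ← proj₂ (∷ʳ⁻ {xs = w} a)
Gen→Gen⁺ (plusNew {w} g)           a =
  Gen⁺-cast (sym (length-∷ʳ w ⊕)) (pnew (Gen→Gen⁺ g (proj₁ (∷ʳ⁻ {xs = w} a))))
Gen→Gen⁺ (plusGraft {w} A l cs B g) a =
  Gen⁺-cast (sym (length-∷ʳ w ⊕)) (pgraft A l cs B (Gen→Gen⁺ g (proj₁ (∷ʳ⁻ {xs = w} a))))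

Gen⁺→Gen : ∀ {n F} → Gen⁺ (suc n) F → Gen (replicate (suc n) ⊕) F
Gen⁺→Gen (pnew empty) = base ⊕
Gen⁺→Gen (pnew {suc n} {F} p) =
  subst₂ Gen (sym (replicate-∷ʳ (suc n) ⊕)) (cong (λ k → F ∷ʳ node (suc k) []) (length-replicate (suc n)))
    (plusNew (Gen⁺→Gen p))
Gen⁺→Gen (pgraft {zero} A l cs B p) with () ← ++-conicalʳ A _ (Gen⁺-zero p)
Gen⁺→Gen (pgraft {suc n} A l cs B p) =
  subst₂ Gen (sym (replicate-∷ʳ (suc n) ⊕))
    (cong (λ k → A ++ [ node l (cs ++ [ node (suc k) B ]) ]) (length-replicate (suc n)))
    (plusGraft A l cs B (Gen⁺→Gen p))

toG⁰ : ∀ {n F} → Gen⁺ (suc n) F → G⁰ F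
toG⁰ {n} p = suc n , s≤s z≤n , Gen⁺→Gen p

toG⁰∪𝟙 : ∀ {n F} → Gen⁺ n F → G⁰∪𝟙 F
toG⁰∪𝟙 {zero}  p = inj₁ (Gen⁺-zero p)
toG⁰∪𝟙 {suc n} p = inj₂ (toG⁰ p)

fromG⁰∪𝟙 : ∀ {F} → G⁰∪𝟙 F → ∃ λ n → Gen⁺ n F
fromG⁰∪𝟙 (inj₁ refl)       = 0 , empty
fromG⁰∪𝟙 (inj₂ (n , _ , g)) =
  n , Gen⁺-cast (length-replicate n) (Gen→Gen⁺ g (replicate⁺ n refl))

shiftF-graft : ∀ p A l cs k B →
               shiftF p (A ++ [ node l (cs ++ [ node k B ]) ]) ≡
               shiftF p A ++ [ node (p + l) (shiftF p cs ++ [ node (p + k) (shiftF p B) ]) ]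
shiftF-graft p A l cs k B =
  trans (shiftF-++ p A _) (cong (λ Y → shiftF p A ++ [ node (p + l) Y ]) (shiftF-++ p cs _))

Gen⁺-++-shiftF : ∀ {p q F G} → Gen⁺ p F → Gen⁺ q G → Gen⁺ (p + q) (F ++ shiftF p G)
Gen⁺-++-shiftF {p} {F = F} pF empty =
  subst₂ Gen⁺ (sym (+-identityʳ p)) (sym (++-identityʳ F)) pF
Gen⁺-++-shiftF {p} {F = F} pF (pnew {q} {G} pG) =
  subst₂ Gen⁺ (sym (+-suc p q)) F++ (pnew (Gen⁺-++-shiftF pF pG))
  where
    open ≡-Reasoning
    F++ : (F ++ shiftF p G) ∷ʳ node (suc (p + q)) [] ≡ F ++ shiftF p (G ∷ʳ node (suc q) [])
    F++ = begin
      (F ++ shiftF p G) ∷ʳ node (suc (p + q)) []  ≡⟨ ++-assoc F (shiftF p G) _ ⟩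
      F ++ shiftF p G ∷ʳ node (suc (p + q)) []    ≡⟨ cong (λ k → F ++ shiftF p G ∷ʳ node k []) (sym (+-suc p q)) ⟩
      F ++ shiftF p G ∷ʳ node (p + suc q) []      ≡⟨ cong (F ++_) (sym (shiftF-++ p G _)) ⟩
      F ++ shiftF p (G ∷ʳ node (suc q) [])        ∎
Gen⁺-++-shiftF {p} {F = F} pF (pgraft {q} A l cs B pG) =
  subst₂ Gen⁺ (sym (+-suc p q)) F++
    (pgraft (F ++ shiftF p A) (p + l) (shiftF p cs) (shiftF p B)
      (subst (Gen⁺ (p + q)) (trans (cong (F ++_) (shiftF-++ p A _)) (sym (++-assoc F _ _)))
        (Gen⁺-++-shiftF pF pG)))
  where
    open ≡-Reasoning
    F++ : (F ++ shiftF p A) ++ [ node (p + l) (shiftF p cs ++ [ node (suc (p + q)) (shiftF p B) ]) ] ≡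
          F ++ shiftF p (A ++ [ node l (cs ++ [ node (suc q) B ]) ])
    F++ = begin
      (F ++ shiftF p A) ++ [ node (p + l) (shiftF p cs ++ [ node (suc (p + q)) (shiftF p B) ]) ]
        ≡⟨ ++-assoc F (shiftF p A) _ ⟩
      F ++ shiftF p A ++ [ node (p + l) (shiftF p cs ++ [ node (suc (p + q)) (shiftF p B) ]) ]
        ≡⟨ cong (λ k → F ++ shiftF p A ++ [ node (p + l) (shiftF p cs ++ [ node k (shiftF p B) ]) ]) (sym (+-suc p q)) ⟩
      F ++ shiftF p A ++ [ node (p + l) (shiftF p cs ++ [ node (p + suc q) (shiftF p B) ]) ]
        ≡⟨ cong (F ++_) (sym (shiftF-graft p A l cs (suc q) B)) ⟩
      F ++ shiftF p (A ++ [ node l (cs ++ [ node (suc q) B ]) ])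
        ∎

Gen⁺-· : ∀ {p q F G} → Gen⁺ p F → Gen⁺ q G → Gen⁺ (p + q) (F · G)
Gen⁺-· {p} {q} {G = G} pF pG =
  subst (λ k → Gen⁺ (p + q) (_ ++ shiftF k G)) (sym (Gen⁺-size pF)) (Gen⁺-++-shiftF pF pG)

HeadSplit : Tree → Forest → Set
HeadSplit t R = Gen⁺ (sizeT t) [ t ] × ∃₂ λ q R′ → Gen⁺ q R′ × R ≡ shiftF (sizeT t) R′

Gen⁺-size-∷ : ∀ {n q t R R′} → Gen⁺ n (t ∷ R) → Gen⁺ q R′ → R ≡ shiftF (sizeT t) R′ →
              n ≡ sizeT t + q
Gen⁺-size-∷ {n} {q} {t} {R} {R′} pF pR′ R≡ = begin
  n                                     ≡⟨ sym (Gen⁺-size pF) ⟩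
  sizeT t + sizeF R                     ≡⟨ cong (λ X → sizeT t + sizeF X) R≡ ⟩
  sizeT t + sizeF (shiftF (sizeT t) R′) ≡⟨ cong (sizeT t +_) (trans (sizeF-shiftF _ R′) (Gen⁺-size pR′)) ⟩
  sizeT t + q                           ∎
  where open ≡-Reasoning

Gen⁺-headSplit : ∀ {n F} → Gen⁺ n F → ∀ t R → F ≡ t ∷ R → HeadSplit t R
Gen⁺-headSplit (pnew {F = []} p) _ _ refl with refl ← Gen⁺-size p =
  pnew empty , 0 , [] , empty , refl
Gen⁺-headSplit (pnew {n} {h ∷ H} p) h _ refl with Gen⁺-headSplit p h H refl
... | ph , q , R′ , pR′ , H≡ =
  ph , suc q , R′ ∷ʳ node (suc q) [] , pnew pR′ ,
  trans (cong₂ (λ X k → X ∷ʳ node k []) H≡ (trans (cong suc (Gen⁺-size-∷ p pR′ H≡)) (sym (+-suc _ q))))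
        (sym (shiftF-++ _ R′ _))
Gen⁺-headSplit (pgraft {n} [] l cs B p) _ _ refl =
  Gen⁺-cast (trans (sym (Gen⁺-size t∈)) (+-identityʳ _)) t∈ , 0 , [] , empty , refl
  where
    t∈ : Gen⁺ (suc n) [ node l (cs ++ [ node (suc n) B ]) ]
    t∈ = pgraft [] l cs B p
Gen⁺-headSplit (pgraft {n} (a ∷ A) l cs B p) a _ refl with Gen⁺-headSplit p a (A ++ node l cs ∷ B) refl
... | pa , q , R₀ , pR₀ , A++≡ with shiftF-++⁻ (sizeT a) R₀ A (node l cs ∷ B) (sym A++≡)
... | X₁ , node l′ cs′ ∷ X₂ , R₀≡ , X₁≡ , refl =
  pa , suc q , X₁ ++ [ node l′ (cs′ ++ [ node (suc q) X₂ ]) ] ,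
  pgraft X₁ l′ cs′ X₂ (subst (Gen⁺ q) R₀≡ pR₀) ,
  trans (cong₂ (λ X k → X ++ [ node (sizeT a + l′) (shiftF (sizeT a) cs′ ++ [ node k (shiftF (sizeT a) X₂) ]) ])
               (sym X₁≡) (trans (cong suc (Gen⁺-size-∷ p pR₀ A++≡)) (sym (+-suc _ q))))
        (sym (shiftF-graft (sizeT a) X₁ l′ cs′ (suc q) X₂))

IsTree : Forest → Set
IsTree b = ∃ λ t → b ≡ [ t ]

Generator : Forest → Set
Generator b = G⁰ b × IsTree b

Gen⁺-factorise : ∀ {n F} → Gen⁺ n F → Acc _<_ n → ∃ λ bs → All Generator bs × prod bs ≡ F
Gen⁺-factorise {F = []} _ _ = [] , [] , refl
Gen⁺-factorise {n} {F = t@(node _ _) ∷ R} pF (acc rec) with Gen⁺-headSplit pF t R refl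
... | pt , q , R′ , pR′ , R≡ with Gen⁺-factorise pR′ (rec q<n)
  where
    q<n : q < n
    q<n = subst (q <_) (sym (Gen⁺-size-∷ pF pR′ R≡)) (m<n+m q (s≤s z≤n))
... | bs , gs , prod≡ =
  [ t ] ∷ bs , (toG⁰ pt , t , refl) ∷ gs ,
  cong (t ∷_) (trans (cong (λ k → shiftF k (prod bs)) (+-identityʳ (sizeT t)))
                     (trans (cong (shiftF (sizeT t)) prod≡) (sym R≡)))

prod-injective : ∀ {cs ds} → All IsTree cs → All IsTree ds → prod cs ≡ prod ds → cs ≡ ds
prod-injective []               []               _  = refl
prod-injective []               ((v , refl) ∷ _) ()
prod-injective ((u , refl) ∷ _) []               ()
prod-injective ((u , refl) ∷ cs) ((v , refl) ∷ ds) eq with refl , shifts≡ ← ∷-injective eq =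
  cong ([ u ] ∷_) (prod-injective cs ds (shiftF-injective _ shifts≡))

mainTheorem3 : IsFreeMonoid G⁰∪𝟙
mainTheorem3 = inj₁ refl , ·-closed , Generator , (λ _ → inj₂ ∘ proj₁) , factorisation
  where
    ·-closed : ∀ F G → G⁰∪𝟙 F → G⁰∪𝟙 G → G⁰∪𝟙 (F · G)
    ·-closed F G F∈ G∈ = toG⁰∪𝟙 (Gen⁺-· (proj₂ (fromG⁰∪𝟙 F∈)) (proj₂ (fromG⁰∪𝟙 G∈)))

    factorisation : ∀ F → G⁰∪𝟙 F → ∃ λ bs → All Generator bs × prod bs ≡ F ×
                      (∀ cs → All Generator cs → prod cs ≡ F → cs ≡ bs)
    factorisation F F∈ with n , pF ← fromG⁰∪𝟙 F∈ with bs , gs , prod≡ ← Gen⁺-factorise pF (<-wellFounded n) =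
      bs , gs , prod≡ ,
      λ cs gs′ prod≡′ → prod-injective (All.map proj₂ gs′) (All.map proj₂ gs) (trans prod≡′ (sym prod≡))
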